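{- Let $A,B$ be a basis of a lattice $\Lambda=\mathbb{Z}A+\mathbb{Z}B\subset\mathbb{R}^2$ and let $T$ be the linear map with $T(A)=-A$, $T(B)=B$. Let $a,d$ be positive integers with $ad=n$, let $0\le b<d$, and let $K$ be the subgroup of $\Lambda$ generated by $aA+bB$ and $dB$. Then $T(K)=K$ if and only if $d\mid 2b$. Consequently the number of subgroups $K\le \Lambda$ of index $n$ with $T(K)=K$ equals $$g(n)=\sum_{d\mid n,\ 2\mid d}2+\sum_{d\mid n,\ 2\nmid d}1.$$
   Context: This concerns $n$-sheeted toroidal covers $X=E/K$ of the minimal toroidal map of a tiling $E$ (types $[3^3,4^2;3^2,4^1,3^1,4^1]$ in the paper) having a glide reflection symmetry whose linear part has matrix $\begin{bmatrix}-1&0\\0&1\end{bmatrix}$ with respect to $A,B$; the glide lies in $\mathrm{Aut}(X)$ iff its linear part $T$ maps $K$ onto itself. Every index-$n$ subgroup of $\Lambda$ is generated by $aA+bB$ and $dB$ for a unique triple $a,d>0$, $ad=n$, $0\le b<d$. -}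

module Defs where

open import Data.Nat as ℕ using (ℕ; suc; _≤_; _<_)
open import Data.Nat.Divisibility using (_∣?_)
open import Data.Integer as ℤ using (ℤ; +_)
open import Data.Product using (_×_; _,_; Σ; ∃; ∃-syntax)
open import Data.List using (List; map; filter; upTo)
open import Data.Nat.ListAction using (sum)
open import Relation.Nullary.Decidable using (does)
open import Data.Bool using (if_then_else_)
open import Relation.Binary.PropositionalEquality using (_≡_)

-- The lattice Λ = ℤA + ℤB, written in coordinates with respect to the basis A, B:
-- the pair (x , y) stands for xA + yB.
Λ : Set
Λ = ℤ × ℤ

T : Λ → Λ
T (x , y) = (ℤ.- x , y)

_∈K[_,_,_] : Λ → ℕ → ℕ → ℕ → Set
(x , y) ∈K[ a , b , d ] =
  ∃[ s ] ∃[ t ] (x ≡ s ℤ.* + a × y ≡ s ℤ.* + b ℤ.+ t ℤ.* + d)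

TK≡K : ℕ → ℕ → ℕ → Set
TK≡K a b d =
  ((v : Λ) → v ∈K[ a , b , d ] → T v ∈K[ a , b , d ]) ×
  ((v : Λ) → v ∈K[ a , b , d ] → ∃[ w ] (w ∈K[ a , b , d ] × T w ≡ v))

-- Index-n triples (a,b,d): a,d > 0, a*d = n, 0 ≤ b < d.  By the standing parametrization
-- these are in bijection with the index-n subgroups of Λ via (a,b,d) ↦ K(a,b,d).
IndexTriple : ℕ → ℕ → ℕ → ℕ → Set
IndexTriple n a b d = (0 < a) × (0 < d) × (a ℕ.* d ≡ n) × (b < d)

divisors : ℕ → List ℕ
divisors n = filter (_∣? n) (map suc (upTo n))

g : ℕ → ℕ
g n = sum (map (λ d → if does (2 ∣? d) then 2 else 1) (divisors n))

{-# OPTIONS --safe #-}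
-- T fixes dB and sends aA + bB to -(aA + bB) + 2bB, so T(K) ⊆ K exactly when
-- 2bB ∈ K ∩ ℤB = ℤdB, i.e. d ∣ 2b; as T is an involution, T(K) ⊆ K already gives
-- T(K) = K.  For a fixed divisor d of n the admissible b < d are the 2-torsion points
-- of ℤ/d: only 0 when d is odd, and 0 and d/2 when d is even.
module Submission where

open import Defs
open import Data.Nat using (ℕ; _*_; _<_)
open import Data.Nat.Divisibility using (_∣_)
open import Relation.Binary.PropositionalEquality using (_≡_)
open import Data.Product using (_×_; _,_; ∃; ∃-syntax)
open import Data.List using (List; length)
open import Data.List.Membership.Propositional using (_∈_)
open import Data.List.Relation.Unary.Unique.Propositional using (Unique)
open import Function.Bundles using (_⇔_)

open import Data.Bool using (if_then_else_)
open import Data.Empty using (⊥-elim)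
open import Data.Integer as ℤ using (+_)
import Data.Integer.Divisibility.Signed as ℤ∣
import Data.Integer.Properties as ℤₚ
open import Data.Integer.Tactic.RingSolver using (solve)
open import Data.List using ([]; _∷_; map; concatMap; upTo)
open import Data.List.Membership.Propositional using (find; lose)
open import Data.List.Membership.Propositional.Properties
  using (∈-map⁻; ∈-map⁺; ∈-filter⁻; ∈-filter⁺; ∈-upTo⁺; ∈-concatMap⁻; ∈-concatMap⁺)
open import Data.List.Properties using (length-++; length-map; map-cong)
open import Data.List.Relation.Binary.Disjoint.Propositional using (Disjoint)
open import Data.List.Relation.Unary.All using (All; tabulate)
import Data.List.Relation.Unary.All.Properties as Allₚ
import Data.List.Relation.Unary.AllPairs as AllPairs
import Data.List.Relation.Unary.AllPairs.Properties as AllPairsₚ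
open import Data.List.Relation.Unary.Any using (here; there)
import Data.List.Relation.Unary.Unique.Propositional.Properties as Unique
open import Data.Nat using (zero; suc; _+_; _/_; z<s; NonZero; >-nonZero)
open import Data.Nat.DivMod using (m*n/n≡m; m/n*n≡m)
open import Data.Nat.Divisibility using (divides; _∣?_; _∣0; ∣⇒≤; 0∣⇒≡0; ∣-reflexive)
open import Data.Nat.ListAction using (sum)
import Data.Nat.Properties as ℕₚ
open import Data.Product using (proj₁; proj₂)
open import Function.Base using (_∘_)
open import Function.Bundles using (mk⇔; Equivalence)
open import Level using (Level)
open import Relation.Binary.PropositionalEquality
  using (_≢_; refl; sym; trans; cong; subst; module ≡-Reasoning)
open import Relation.Nullary using (yes; no; does)
open import Relation.Nullary.Decidable using (dec-true; dec-false)

private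
  variable
    ℓ₁ ℓ₂ : Level
    A : Set ℓ₁
    B : Set ℓ₂

s*i+t*j≡-s*i+[s*q+t]*j : ∀ s t q i j → q ℤ.* j ≡ + 2 ℤ.* i →
                         s ℤ.* i ℤ.+ t ℤ.* j ≡ ℤ.- s ℤ.* i ℤ.+ (s ℤ.* q ℤ.+ t) ℤ.* j
s*i+t*j≡-s*i+[s*q+t]*j s t q i j qj≡2i = begin
  s ℤ.* i ℤ.+ t ℤ.* j                             ≡⟨ solve (s ∷ t ∷ i ∷ j ∷ []) ⟩
  ℤ.- s ℤ.* i ℤ.+ s ℤ.* (+ 2 ℤ.* i) ℤ.+ t ℤ.* j  ≡⟨ cong (λ m → ℤ.- s ℤ.* i ℤ.+ s ℤ.* m ℤ.+ t ℤ.* j) qj≡2i ⟨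
  ℤ.- s ℤ.* i ℤ.+ s ℤ.* (q ℤ.* j) ℤ.+ t ℤ.* j    ≡⟨ solve (s ∷ t ∷ q ∷ i ∷ j ∷ []) ⟩
  ℤ.- s ℤ.* i ℤ.+ (s ℤ.* q ℤ.+ t) ℤ.* j          ∎
  where open ≡-Reasoning

i≡-i+j⇒2*i≡j : ∀ i j → i ≡ ℤ.- i ℤ.+ j → + 2 ℤ.* i ≡ j
i≡-i+j⇒2*i≡j i j i≡-i+j = begin
  + 2 ℤ.* i              ≡⟨ solve (i ∷ []) ⟩
  i ℤ.+ i                ≡⟨ cong (λ m → i ℤ.+ m) i≡-i+j ⟩
  i ℤ.+ (ℤ.- i ℤ.+ j)    ≡⟨ solve (i ∷ j ∷ []) ⟩
  j                      ∎
  where open ≡-Reasoning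

TK⊆K : ℕ → ℕ → ℕ → Set
TK⊆K a b d = (v : Λ) → v ∈K[ a , b , d ] → T v ∈K[ a , b , d ]

T-involutive : (v : Λ) → T (T v) ≡ v
T-involutive (x , y) = cong (_, y) (ℤₚ.neg-involutive x)

TK⊆K⇒TK≡K : ∀ {a b d} → TK⊆K a b d → TK≡K a b d
TK⊆K⇒TK≡K TK⊆K = TK⊆K , λ v v∈K → T v , TK⊆K v v∈K , T-involutive v

generator∈K : ∀ {a b d} → (+ a , + b) ∈K[ a , b , d ]
generator∈K {a} {b} {d} = ℤ.1ℤ , ℤ.0ℤ , sym (ℤₚ.*-identityˡ (+ a)) , sym (begin
  ℤ.1ℤ ℤ.* + b ℤ.+ ℤ.0ℤ ℤ.* + d  ≡⟨ ℤₚ.+-identityʳ (ℤ.1ℤ ℤ.* + b) ⟩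
  ℤ.1ℤ ℤ.* + b                   ≡⟨ ℤₚ.*-identityˡ (+ b) ⟩
  + b                            ∎)
  where open ≡-Reasoning

d∣2b⇒TK⊆K : ∀ {a b d} → d ∣ 2 * b → TK⊆K a b d
d∣2b⇒TK⊆K {a} {b} {d} d∣2b (x , y) (s , t , x≡s*a , y≡s*b+t*d)
  with ℤ∣.∣ᵤ⇒∣ {+ d} {+ (2 * b)} d∣2b
... | ℤ∣.divides q 2b≡q*d = ℤ.- s , s ℤ.* q ℤ.+ t , -x≡-s*a , y≡-s*b+[s*q+t]*d
  where
  -x≡-s*a : ℤ.- x ≡ ℤ.- s ℤ.* + a
  -x≡-s*a = trans (cong ℤ.-_ x≡s*a) (ℤₚ.neg-distribˡ-* s (+ a))
  y≡-s*b+[s*q+t]*d : y ≡ ℤ.- s ℤ.* + b ℤ.+ (s ℤ.* q ℤ.+ t) ℤ.* + d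
  y≡-s*b+[s*q+t]*d = trans y≡s*b+t*d (s*i+t*j≡-s*i+[s*q+t]*j s t q (+ b) (+ d)
    (trans (sym 2b≡q*d) (ℤₚ.pos-* 2 b)))

TK⊆K⇒d∣2b : ∀ {a b d} → 0 < a → TK⊆K a b d → d ∣ 2 * b
TK⊆K⇒d∣2b {a} {b} {d} 0<a TK⊆K with TK⊆K (+ a , + b) generator∈K
... | s , t , -a≡s*a , b≡s*b+t*d = ℤ∣.∣⇒∣ᵤ (ℤ∣.divides t 2b≡t*d)
  where
  instance
    a≢0 : NonZero a
    a≢0 = >-nonZero 0<a
  s≡-1 : s ≡ ℤ.-1ℤ
  s≡-1 = ℤₚ.*-cancelʳ-≡ s ℤ.-1ℤ (+ a) (trans (sym -a≡s*a) (sym (ℤₚ.-1*i≡-i (+ a))))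
  s*b≡-b : s ℤ.* + b ≡ ℤ.- + b
  s*b≡-b = trans (cong (λ r → r ℤ.* + b) s≡-1) (ℤₚ.-1*i≡-i (+ b))
  2b≡t*d : + (2 * b) ≡ t ℤ.* + d
  2b≡t*d = trans (ℤₚ.pos-* 2 b) (i≡-i+j⇒2*i≡j (+ b) (t ℤ.* + d)
    (trans b≡s*b+t*d (cong (λ r → r ℤ.+ t ℤ.* + d) s*b≡-b)))

TK≡K⇔d∣2b : ∀ {a b d} → 0 < a → TK≡K a b d ⇔ d ∣ 2 * b
TK≡K⇔d∣2b 0<a = mk⇔ (TK⊆K⇒d∣2b 0<a ∘ proj₁) (TK⊆K⇒TK≡K ∘ d∣2b⇒TK⊆K)

length-concatMap : (f : A → List B) (xs : List A) →
                   length (concatMap f xs) ≡ sum (map (length ∘ f) xs)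
length-concatMap f []       = refl
length-concatMap f (x ∷ xs) =
  trans (length-++ (f x)) (cong (λ m → length (f x) + m) (length-concatMap f xs))

Unique-concatMap⁺ : (f : A → List B) (key : B → A) → (∀ {x y} → y ∈ f x → key y ≡ x) →
                    ∀ {xs} → Unique xs → All (Unique ∘ f) xs → Unique (concatMap f xs)
Unique-concatMap⁺ f key key∘f xs! fxs! =
  Unique.concat⁺ (Allₚ.map⁺ fxs!) (AllPairsₚ.map⁺ (AllPairs.map disjoint xs!))
  where
  disjoint : ∀ {x x′} → x ≢ x′ → Disjoint (f x) (f x′)
  disjoint x≢x′ (y∈fx , y∈fx′) = x≢x′ (trans (sym (key∘f y∈fx)) (key∘f y∈fx′))

0<m*n⇒0<m : ∀ m {n} → 0 < m * n → 0 < m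
0<m*n⇒0<m (suc _) _ = z<s

∈-divisors⁻ : ∀ {d n} → d ∈ divisors n → 0 < d × d ∣ n
∈-divisors⁻ {n = n} d∈ with ∈-filter⁻ (_∣? n) {xs = map suc (upTo n)} d∈
... | d∈1+upTo , d∣n with ∈-map⁻ suc d∈1+upTo
... | _ , _ , refl = z<s , d∣n

∈-divisors⁺ : ∀ {d n} → 0 < n → d ∣ n → d ∈ divisors n
∈-divisors⁺ {zero}  0<n 0∣n = ⊥-elim (ℕₚ.n>0⇒n≢0 0<n (0∣⇒≡0 0∣n))
∈-divisors⁺ {suc _} {n@(suc _)} _ d∣n =
  ∈-filter⁺ (_∣? n) (∈-map⁺ suc (∈-upTo⁺ (∣⇒≤ d∣n))) d∣n

divisors-unique : ∀ n → Unique (divisors n)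
divisors-unique n = Unique.filter⁺ (_∣? n) (Unique.map⁺ ℕₚ.suc-injective (Unique.upTo⁺ n))

twoTorsion : ℕ → List ℕ
twoTorsion d with 2 ∣? d
... | yes (divides h _) = 0 ∷ h ∷ []
... | no _              = 0 ∷ []

length-twoTorsion : ∀ d → length (twoTorsion d) ≡ (if does (2 ∣? d) then 2 else 1)
length-twoTorsion d with 2 ∣? d
... | yes 2∣d rewrite dec-true  (2 ∣? d) 2∣d = refl
... | no  2∤d rewrite dec-false (2 ∣? d) 2∤d = refl

module _ where
  open import Data.List.Relation.Unary.All using ([]; _∷_)
  open import Data.List.Relation.Unary.AllPairs using ([]; _∷_)

  twoTorsion-unique : ∀ {d} → 0 < d → Unique (twoTorsion d)
  twoTorsion-unique {d} 0<d with 2 ∣? d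
  ... | yes (divides h refl) = (0≢h ∷ []) ∷ [] ∷ []
    where
    0≢h : 0 ≢ h
    0≢h 0≡h = ℕₚ.n>0⇒n≢0 (0<m*n⇒0<m h 0<d) (sym 0≡h)
  ... | no _ = [] ∷ []

0∈twoTorsion : ∀ d → 0 ∈ twoTorsion d
0∈twoTorsion d with 2 ∣? d
... | yes _ = here refl
... | no _  = here refl

h∈twoTorsion[h*2] : ∀ h → h ∈ twoTorsion (h * 2)
h∈twoTorsion[h*2] h with 2 ∣? (h * 2)
... | yes (divides h′ h*2≡h′*2) = there (here (ℕₚ.*-cancelʳ-≡ h h′ 2 h*2≡h′*2))
... | no 2∤h*2                 = ⊥-elim (2∤h*2 (divides h refl))

twoTorsion-sound : ∀ {b d} → 0 < d → b ∈ twoTorsion d → b < d × d ∣ 2 * b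
twoTorsion-sound {d = d} 0<d b∈ with 2 ∣? d
twoTorsion-sound 0<d (here refl)         | yes _ = 0<d , _ ∣0
twoTorsion-sound 0<d (there (here refl)) | yes (divides h refl) =
  ℕₚ.m<m*n h 2 {{ℕₚ.m*n≢0⇒m≢0 h {{>-nonZero 0<d}}}} ℕₚ.≤-refl , ∣-reflexive (ℕₚ.*-comm h 2)
twoTorsion-sound 0<d (here refl)         | no _  = 0<d , _ ∣0

twoTorsion-complete : ∀ {b d} → b < d → d ∣ 2 * b → b ∈ twoTorsion d
twoTorsion-complete {zero}  {d} _ _ = 0∈twoTorsion d
twoTorsion-complete {suc b} {d} _ (divides 1 2b≡d) =
  subst (λ x → suc b ∈ twoTorsion x) b*2≡d (h∈twoTorsion[h*2] (suc b))
  where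
  b*2≡d : suc b * 2 ≡ d
  b*2≡d = trans (ℕₚ.*-comm (suc b) 2) (trans 2b≡d (ℕₚ.+-identityʳ d))
twoTorsion-complete {suc b} {d} b<d (divides (suc (suc q)) 2b≡[2+q]d) =
  ⊥-elim (ℕₚ.<-irrefl 2b≡[2+q]d 2b<[2+q]d)
  where
  2b<[2+q]d : 2 * suc b < (2 + q) * d
  2b<[2+q]d = ℕₚ.<-≤-trans (ℕₚ.*-monoʳ-< 2 b<d) (ℕₚ.*-monoˡ-≤ d (ℕₚ.m≤m+n 2 q))

-- n / d; the value at d = 0 is junk, as 0 divides no n > 0.
cofactor : ℕ → ℕ → ℕ
cofactor n zero      = 0
cofactor n d@(suc _) = n / d

cofactor-*ʳ : ∀ a {d} → 0 < d → cofactor (a * d) d ≡ a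
cofactor-*ʳ a {suc _} _ = m*n/n≡m a _

cofactor-* : ∀ {n d} → 0 < d → d ∣ n → cofactor n d * d ≡ n
cofactor-* {d = suc _} _ d∣n = m/n*n≡m d∣n

triplesOver : ℕ → ℕ → List (ℕ × ℕ × ℕ)
triplesOver n d = map (λ b → (cofactor n d , b , d)) (twoTorsion d)

invariantTriples : ℕ → List (ℕ × ℕ × ℕ)
invariantTriples n = concatMap (triplesOver n) (divisors n)

length-invariantTriples : ∀ n → length (invariantTriples n) ≡ g n
length-invariantTriples n = begin
  length (concatMap (triplesOver n) (divisors n))  ≡⟨ length-concatMap (triplesOver n) (divisors n) ⟩
  sum (map (length ∘ triplesOver n) (divisors n))  ≡⟨ cong sum (map-cong length-triplesOver (divisors n)) ⟩
  g n                                              ∎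
  where
  open ≡-Reasoning
  length-triplesOver : ∀ d → length (triplesOver n d) ≡ (if does (2 ∣? d) then 2 else 1)
  length-triplesOver d = trans (length-map _ (twoTorsion d)) (length-twoTorsion d)

invariantTriples-unique : ∀ n → Unique (invariantTriples n)
invariantTriples-unique n =
  Unique-concatMap⁺ (triplesOver n) (proj₂ ∘ proj₂) third∘triplesOver (divisors-unique n)
    (tabulate λ d∈ → Unique.map⁺ (cong (proj₁ ∘ proj₂))
                                 (twoTorsion-unique (proj₁ (∈-divisors⁻ {n = n} d∈))))
  where
  third∘triplesOver : ∀ {d t} → t ∈ triplesOver n d → proj₂ (proj₂ t) ≡ d
  third∘triplesOver t∈ with ∈-map⁻ _ t∈
  ... | _ , _ , refl = refl

∈-invariantTriples⁻ : ∀ {n a b d} → 0 < n → (a , b , d) ∈ invariantTriples n →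
                      IndexTriple n a b d × d ∣ 2 * b
∈-invariantTriples⁻ {n} 0<n t∈ with find (∈-concatMap⁻ (triplesOver n) {xs = divisors n} t∈)
... | d , d∈ , t∈d with ∈-map⁻ _ t∈d | ∈-divisors⁻ d∈
... | b , b∈ , refl | 0<d , d∣n with twoTorsion-sound 0<d b∈
... | b<d , d∣2b = (0<a , 0<d , a*d≡n , b<d) , d∣2b
  where
  a*d≡n = cofactor-* 0<d d∣n
  0<a = 0<m*n⇒0<m _ (subst (0 <_) (sym a*d≡n) 0<n)

∈-invariantTriples⁺ : ∀ {n a b d} → IndexTriple n a b d → d ∣ 2 * b →
                      (a , b , d) ∈ invariantTriples n
∈-invariantTriples⁺ {a = a@(suc _)} {b} {d@(suc _)} (_ , _ , refl , b<d) d∣2b =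
  ∈-concatMap⁺ (triplesOver (a * d)) (lose d∈divisors t∈triplesOver)
  where
  d∈divisors : d ∈ divisors (a * d)
  d∈divisors = ∈-divisors⁺ z<s (divides a refl)
  t∈triplesOver : (a , b , d) ∈ triplesOver (a * d) d
  t∈triplesOver = subst (λ x → (x , b , d) ∈ triplesOver (a * d) d) (cofactor-*ʳ a {d} z<s)
    (∈-map⁺ _ (twoTorsion-complete b<d d∣2b))

∈-invariantTriples⇔ : ∀ {n a b d} → 0 < n →
                      (a , b , d) ∈ invariantTriples n ⇔ (IndexTriple n a b d × TK≡K a b d)
∈-invariantTriples⇔ 0<n = mk⇔
  (λ t∈ → let (it , d∣2b) = ∈-invariantTriples⁻ 0<n t∈
          in it , Equivalence.from (TK≡K⇔d∣2b (proj₁ it)) d∣2b)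
  (λ (it , TK≡K) → ∈-invariantTriples⁺ it (Equivalence.to (TK≡K⇔d∣2b (proj₁ it)) TK≡K))

lemma4 :
    ((n a b d : ℕ) → IndexTriple n a b d → (TK≡K a b d ⇔ (d ∣ 2 * b)))
    × ((n : ℕ) → 0 < n →
        ∃[ L ] (Unique L
          × ((a b d : ℕ) → ((a , b , d) ∈ L) ⇔ (IndexTriple n a b d × TK≡K a b d))
          × length L ≡ g n))
lemma4 =
  (λ _ _ _ _ (0<a , _) → TK≡K⇔d∣2b 0<a) ,
  λ n 0<n → invariantTriples n , invariantTriples-unique n ,
            (λ _ _ _ → ∈-invariantTriples⇔ 0<n) , length-invariantTriples n
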